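{- Let $f:B\to A$ be a cover. Then $|{\rm Aut}(f)|\le\deg f$. Furthermore, let $B\xleftarrow{p}U\xrightarrow{q}B$ be a pullback of $B\xrightarrow{f}A\xleftarrow{f}B$. Then the following are equivalent: (i) $f$ is Galois; (ii) $\deg(p\circ i)=1$ for all $i\in\Sigma(U)$; (iii) $\deg(q\circ i)=1$ for all $i\in\Sigma(U)$.
   Context: Let $\mathbf C$ be a category and $\mathbf D$ a full subcategory of $\mathbf C$. For arrows $f,g$ of $\mathbf C$ with ${\rm cod}\,f={\rm cod}\,g$, ${\rm Hom}(g,f)$ denotes the collection of all arrows $h$ of $\mathbf C$ with $g=f\circ h$. Standing assumptions: (G1) every diagram $B\to A\leftarrow C$ in $\mathbf D$ has a pullback in $\mathbf C$. (G2) (I) pushouts exist in $\mathbf D$; (II) every arrow of $\mathbf D$ is epic; (III) every monic arrow of $\mathbf D$ is an isomorphism whose inverse is an arrow of $\mathbf D$. (G3) for every object $U$ of $\mathbf C$ there is a set $\Sigma(U)$ of arrows $i$ of $\mathbf C$ with ${\rm dom}\,i$ in $\mathbf D$ and ${\rm cod}\,i=U$ such that for every arrow $u$ of $\mathbf C$ with ${\rm dom}\,u$ in $\mathbf D$ and ${\rm cod}\,u=U$ there is exactly one $i\in\Sigma(U)$ with ${\rm Hom}(u,i)\neq\emptyset$. (G4) there is a function $\deg$ from the collection of arrows of $\mathbf C$ whose codomain lies in $\mathbf D$ to the positive integers such that (I) $\deg(g\circ f)=\deg g\cdot\deg f$ whenever $f,g,g\circ f$ all lie in this collection; (II) $\deg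 f=\sum_{i\in\Sigma({\rm dom}\,f)}\deg(f\circ i)$ for every such $f$; (III) if $B\xrightarrow{f}A\xleftarrow{g}C$ is a diagram in $\mathbf D$ with pullback $B\xleftarrow{p}U\xrightarrow{q}C$, then $\deg f=\deg q$ and $\deg g=\deg p$. A cover is an arrow of $\mathbf D$. For a cover $f$, ${\rm Aut}(f)$ is the set of isomorphisms in ${\rm Hom}(f,f)$; $f$ is Galois if $|{\rm Aut}(f)|=\deg f$. -}

module Defs where

open import Level using (Level; _⊔_) renaming (suc to lsuc)
open import Data.Nat using (ℕ; zero; suc; _+_; _*_; _≤_)
open import Data.Fin using (Fin) renaming (zero to fz; suc to fs)
open import Data.Product using (Σ; _×_; _,_; proj₁)
open import Relation.Binary.PropositionalEquality using (_≡_)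
open import Function.Definitions using (Bijective)

sumFin : (n : ℕ) → (Fin n → ℕ) → ℕ
sumFin zero    a = 0
sumFin (suc n) a = a fz + sumFin n (λ k → a (fs k))

record Category (o ℓ : Level) : Set (lsuc (o ⊔ ℓ)) where
  infixr 9 _∘_
  field
    Obj   : Set o
    Hom   : Obj → Obj → Set ℓ
    id    : ∀ {X} → Hom X X
    _∘_   : ∀ {X Y Z} → Hom Y Z → Hom X Y → Hom X Z
    idˡ   : ∀ {X Y} (f : Hom X Y) → id ∘ f ≡ f
    idʳ   : ∀ {X Y} (f : Hom X Y) → f ∘ id ≡ f
    assoc : ∀ {W X Y Z} (h : Hom Y Z) (g : Hom X Y) (f : Hom W X) →
            (h ∘ g) ∘ f ≡ h ∘ (g ∘ f)

module _ {o ℓ : Level} (C : Category o ℓ) where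
  open Category C

  IsIso : ∀ {X Y} → Hom X Y → Set ℓ
  IsIso {X} {Y} f = Σ (Hom Y X) λ g → (g ∘ f ≡ id) × (f ∘ g ≡ id)

  HomOver : ∀ {X Y Z} → Hom X Z → Hom Y Z → Set ℓ
  HomOver {X} {Y} g f = Σ (Hom X Y) λ h → g ≡ f ∘ h

  IsPullback : ∀ {A B C' U} → Hom B A → Hom C' A → Hom U B → Hom U C' → Set (o ⊔ ℓ)
  IsPullback {A} {B} {C'} {U} f g p q =
    (f ∘ p ≡ g ∘ q) ×
    (∀ {W} (p' : Hom W B) (q' : Hom W C') → f ∘ p' ≡ g ∘ q' →
       Σ (Hom W U) λ m → ((p ∘ m ≡ p') × (q ∘ m ≡ q')) ×
         (∀ (m' : Hom W U) → p ∘ m' ≡ p' → q ∘ m' ≡ q' → m' ≡ m))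

  module _ (inD : Obj → Set o) where

    IsPushoutD : ∀ {A B C' P} → Hom A B → Hom A C' → Hom B P → Hom C' P → Set (o ⊔ ℓ)
    IsPushoutD {A} {B} {C'} {P} f g i₁ i₂ =
      (i₁ ∘ f ≡ i₂ ∘ g) ×
      (∀ {W} → inD W → (j₁ : Hom B W) (j₂ : Hom C' W) → j₁ ∘ f ≡ j₂ ∘ g →
         Σ (Hom P W) λ m → ((m ∘ i₁ ≡ j₁) × (m ∘ i₂ ≡ j₂)) ×
           (∀ (m' : Hom P W) → m' ∘ i₁ ≡ j₁ → m' ∘ i₂ ≡ j₂ → m' ≡ m))

    IsEpicD : ∀ {X Y} → Hom X Y → Set (o ⊔ ℓ)
    IsEpicD {X} {Y} f = ∀ {W} → inD W → (g h : Hom Y W) → g ∘ f ≡ h ∘ f → g ≡ h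

    IsMonicD : ∀ {X Y} → Hom X Y → Set (o ⊔ ℓ)
    IsMonicD {X} {Y} f = ∀ {W} → inD W → (g h : Hom W X) → f ∘ g ≡ f ∘ h → g ≡ h

record SigElem {o ℓ} (C : Category o ℓ) (inD : Category.Obj C → Set o)
               (U : Category.Obj C) : Set (o ⊔ ℓ) where
  constructor sigElem
  open Category C
  field
    sdom  : Obj
    sdomD : inD sdom
    sarr  : Hom sdom U

record GaloisSetting (o ℓ : Level) : Set (lsuc (o ⊔ ℓ)) where
  field
    cat : Category o ℓ
  open Category cat
  field
    -- the full subcategory D, given by a proof-irrelevant predicate on objects
    inD      : Obj → Set o
    inD-prop : ∀ {X} (a b : inD X) → a ≡ b
    G1 : ∀ {A B C'} → inD A → inD B → inD C' → (f : Hom B A) (g : Hom C' A) →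
         Σ Obj λ U → Σ (Hom U B) λ p → Σ (Hom U C') λ q → IsPullback cat f g p q
    G2-pushout : ∀ {A B C'} → inD A → inD B → inD C' → (f : Hom A B) (g : Hom A C') →
         Σ Obj λ P → inD P × (Σ (Hom B P) λ i₁ → Σ (Hom C' P) λ i₂ →
           IsPushoutD cat inD f g i₁ i₂)
    G2-epic : ∀ {X Y} → inD X → inD Y → (f : Hom X Y) → IsEpicD cat inD f
    -- (G2)(III)  (the inverse is automatically an arrow of D, D being full)
    G2-monic : ∀ {X Y} → inD X → inD Y → (f : Hom X Y) → IsMonicD cat inD f → IsIso cat f
    -- (G3)  Σ(U) is the index type Sig U
    Sig   : Obj → Set (o ⊔ ℓ)
    elem  : ∀ {U} → Sig U → SigElem cat inD U
    G3-ex : ∀ {X U} → inD X → (u : Hom X U) →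
            Σ (Sig U) λ i → HomOver cat u (SigElem.sarr (elem i))
    G3-un : ∀ {X U} → inD X → (u : Hom X U) → (i j : Sig U) →
            HomOver cat u (SigElem.sarr (elem i)) → HomOver cat u (SigElem.sarr (elem j)) →
            i ≡ j
    deg     : ∀ {X Y} → inD Y → Hom X Y → ℕ
    deg-pos : ∀ {X Y} (dY : inD Y) (f : Hom X Y) → 1 ≤ deg dY f
    G4-mult : ∀ {X Y Z} (dY : inD Y) (dZ : inD Z) (g : Hom Y Z) (f : Hom X Y) →
              deg dZ (g ∘ f) ≡ deg dZ g * deg dY f
    -- (G4)(II)  (the sum of positive integers being a positive integer,
    --  Σ(dom f) is finite; it is enumerated bijectively by Fin n)
    G4-sum : ∀ {U Y} (dY : inD Y) (f : Hom U Y) →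
             Σ ℕ λ n → Σ (Fin n → Sig U) λ e → Bijective _≡_ _≡_ e ×
               (deg dY f ≡ sumFin n (λ k → deg dY (f ∘ SigElem.sarr (elem (e k)))))
    G4-pb : ∀ {A B C' U} (dA : inD A) (dB : inD B) (dC : inD C')
              (f : Hom B A) (g : Hom C' A) (p : Hom U B) (q : Hom U C') →
            IsPullback cat f g p q → (deg dA f ≡ deg dC q) × (deg dA g ≡ deg dB p)

  Aut : ∀ {A B} → Hom B A → Set ℓ
  Aut {A} {B} f = Σ (Hom B B) λ h → IsIso cat h × (f ≡ f ∘ h)

  AutCard≤ : ∀ {A B} → Hom B A → ℕ → Set ℓ
  AutCard≤ f n = Σ (Aut f → Fin n) λ ι → ∀ x y → ι x ≡ ι y → proj₁ x ≡ proj₁ y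

  AutCard≡ : ∀ {A B} → Hom B A → ℕ → Set ℓ
  AutCard≡ f n = Σ (Aut f → Fin n) λ ι → (∀ x y → ι x ≡ ι y → proj₁ x ≡ proj₁ y) ×
                                           (∀ k → Σ (Aut f) λ x → ι x ≡ k)

  IsGalois : ∀ {A B} → inD A → inD B → Hom B A → Set ℓ
  IsGalois dA dB f = AutCard≡ f (deg dA f)

-- Let B ←p− U −q→ B be the kernel pair of f. Every automorphism h of f gives a
-- section ⟨id , h⟩ of p, which factors through exactly one element i of Σ(U);
-- then p ∘ i is a cover with a section, so deg (p ∘ i) = 1, and distinct
-- automorphisms land in distinct elements of Σ(U). Conversely every i ∈ Σ(U)
-- with deg (p ∘ i) = 1 comes from an automorphism, since degree-1 covers are
-- isomorphisms. As deg f = deg p = Σᵢ deg (p ∘ i) is a sum of positive terms,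
-- |Aut f| ≤ #{i | deg (p ∘ i) = 1} ≤ |Σ(U)| ≤ deg f, with equality throughout
-- exactly when every deg (p ∘ i) is 1. Swapping p and q gives (iii).

module Submission where

open import Defs
open import Level using (Level)
open import Data.Nat using (ℕ; zero; suc; _*_; _≤_; z≤n; s≤s; NonZero; >-nonZero)
open import Data.Nat.Properties
  using (+-mono-≤; +-monoˡ-≤; +-cancelʳ-≤; ≤-pred; ≤-trans; ≤-antisym; *-cancelˡ-≡; *-identityʳ)
open import Data.Fin using (Fin; inject≤; toℕ; cast) renaming (zero to fz; suc to fs)
open import Data.Fin.Properties using (toℕ-injective; toℕ-inject≤; toℕ-cast; inject≤-injective; injective⇒≤)
open import Data.Product using (Σ; _×_; _,_; proj₁; proj₂)
open import Relation.Binary.PropositionalEquality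
  using (_≡_; refl; sym; trans; cong; cong₂; subst; module ≡-Reasoning)
open import Function.Bundles using (_⇔_; mk⇔)
open import Function.Definitions using (Injective; Bijective)
open import Axiom.UniquenessOfIdentityProofs.WithK using (uip)

n≤sumFin : ∀ n (a : Fin n → ℕ) → (∀ k → 1 ≤ a k) → n ≤ sumFin n a
n≤sumFin zero    a pos = z≤n
n≤sumFin (suc n) a pos = +-mono-≤ (pos fz) (n≤sumFin n (λ k → a (fs k)) (λ k → pos (fs k)))

sumFin-ones : ∀ n (a : Fin n → ℕ) → (∀ k → a k ≡ 1) → sumFin n a ≡ n
sumFin-ones zero    a ones = refl
sumFin-ones (suc n) a ones
  rewrite ones fz = cong suc (sumFin-ones n (λ k → a (fs k)) (λ k → ones (fs k)))

sumFin≤n⇒ones : ∀ n (a : Fin n → ℕ) → (∀ k → 1 ≤ a k) → sumFin n a ≤ n → ∀ k → a k ≡ 1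
sumFin≤n⇒ones (suc n) a pos sum≤ = ones
  where
  rest : ℕ
  rest = sumFin n (λ k → a (fs k))

  n≤rest : n ≤ rest
  n≤rest = n≤sumFin n (λ k → a (fs k)) (λ k → pos (fs k))

  head≤1 : a fz ≤ 1
  head≤1 = +-cancelʳ-≤ rest (a fz) 1 (≤-trans sum≤ (s≤s n≤rest))

  rest≤n : rest ≤ n
  rest≤n = ≤-pred (≤-trans (+-monoˡ-≤ rest (pos fz)) sum≤)

  ones : ∀ k → a k ≡ 1
  ones fz     = ≤-antisym head≤1 (pos fz)
  ones (fs k) = sumFin≤n⇒ones n (λ k → a (fs k)) (λ k → pos (fs k)) rest≤n k

m*n≡m⇒n≡1 : ∀ m n .{{_ : NonZero m}} → m * n ≡ m → n ≡ 1
m*n≡m⇒n≡1 m n eq = *-cancelˡ-≡ n 1 m (trans eq (sym (*-identityʳ m)))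

Fin1-irrelevant : (a b : Fin 1) → a ≡ b
Fin1-irrelevant fz fz = refl

module WeightedCount {a} {S : Set a} {n : ℕ} (e : Fin n → S) (e-bijective : Bijective _≡_ _≡_ e)
                     (w : S → ℕ) (w-pos : ∀ s → 1 ≤ w s)
                     {W : ℕ} (W≡total : W ≡ sumFin n (λ k → w (e k))) where

  private
    e⁻¹ : S → Fin n
    e⁻¹ s = proj₁ (proj₂ e-bijective s)

    e∘e⁻¹ : ∀ s → e (e⁻¹ s) ≡ s
    e∘e⁻¹ s = proj₂ (proj₂ e-bijective s) refl

    e⁻¹∘e : ∀ k → e⁻¹ (e k) ≡ k
    e⁻¹∘e k = proj₁ e-bijective (e∘e⁻¹ (e k))

    e⁻¹-injective : Injective _≡_ _≡_ e⁻¹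
    e⁻¹-injective {s} {t} eq = trans (sym (e∘e⁻¹ s)) (trans (cong e eq) (e∘e⁻¹ t))

    n≤W : n ≤ W
    n≤W = subst (n ≤_) (sym W≡total) (n≤sumFin n (λ k → w (e k)) (λ k → w-pos (e k)))

  index : S → Fin W
  index s = inject≤ (e⁻¹ s) n≤W

  index-injective : Injective _≡_ _≡_ index
  index-injective eq = e⁻¹-injective (inject≤-injective n≤W n≤W _ _ eq)

  weights≡1⇒index-surjective : (∀ s → w s ≡ 1) → ∀ k → Σ S λ s → index s ≡ k
  weights≡1⇒index-surjective ones k = e k′ , toℕ-injective (begin
      toℕ (inject≤ (e⁻¹ (e k′)) n≤W) ≡⟨ toℕ-inject≤ (e⁻¹ (e k′)) n≤W ⟩
      toℕ (e⁻¹ (e k′))               ≡⟨ cong toℕ (e⁻¹∘e k′) ⟩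
      toℕ k′                         ≡⟨ toℕ-cast W≡n k ⟩
      toℕ k                          ∎)
    where
    open ≡-Reasoning
    W≡n : W ≡ n
    W≡n = trans W≡total (sumFin-ones n (λ k → w (e k)) (λ k → ones (e k)))
    k′ : Fin n
    k′ = cast W≡n k

  injection⇒weights≡1 : (ι : Fin W → S) → Injective _≡_ _≡_ ι → ∀ s → w s ≡ 1
  injection⇒weights≡1 ι ι-injective s = subst (λ t → w t ≡ 1) (e∘e⁻¹ s) (ones (e⁻¹ s))
    where
    total≤n : sumFin n (λ k → w (e k)) ≤ n
    total≤n = subst (_≤ n) W≡total (injective⇒≤ (λ eq → ι-injective (e⁻¹-injective eq)))
    ones : ∀ k → w (e k) ≡ 1
    ones = sumFin≤n⇒ones n (λ k → w (e k)) (λ k → w-pos (e k)) total≤n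

module _ {o ℓ : Level} {C : Category o ℓ} where
  open Category C

  IsPullback-swap : ∀ {A B C′ U} {f : Hom B A} {g : Hom C′ A} {p : Hom U B} {q : Hom U C′} →
                    IsPullback C f g p q → IsPullback C g f q p
  IsPullback-swap (commutes , universal) = sym commutes , λ p′ q′ eq →
    let m , (p∘m , q∘m) , unique = universal q′ p′ (sym eq)
    in m , (q∘m , p∘m) , λ m′ q∘m′ p∘m′ → unique m′ p∘m′ q∘m′

  inverse-unique : ∀ {X Y} (h : Hom X Y) (g g′ : Hom Y X) → g ∘ h ≡ id → h ∘ g′ ≡ id → g ≡ g′
  inverse-unique h g g′ g∘h h∘g′ = begin
    g              ≡⟨ sym (idʳ g) ⟩
    g ∘ id         ≡⟨ cong (g ∘_) (sym h∘g′) ⟩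
    g ∘ (h ∘ g′)   ≡⟨ sym (assoc g h g′) ⟩
    (g ∘ h) ∘ g′   ≡⟨ cong (_∘ g′) g∘h ⟩
    id ∘ g′        ≡⟨ idˡ g′ ⟩
    g′             ∎
    where open ≡-Reasoning

  IsIso-irrelevant : ∀ {X Y} {h : Hom X Y} (a b : IsIso C h) → a ≡ b
  IsIso-irrelevant {h = h} (g , g∘h , h∘g) (g′ , g′∘h , h∘g′)
    with inverse-unique h g g′ g∘h h∘g′
  ... | refl rewrite uip g∘h g′∘h | uip h∘g h∘g′ = refl

module CoverTheory {o ℓ : Level} (G : GaloisSetting o ℓ) where
  open GaloisSetting G
  open Category cat
  open ≡-Reasoning

  arr : ∀ {U} (i : Sig U) → Hom (SigElem.sdom (elem i)) U
  arr i = SigElem.sarr (elem i)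

  arrD : ∀ {U} (i : Sig U) → inD (SigElem.sdom (elem i))
  arrD i = SigElem.sdomD (elem i)

  retractions-unique : ∀ {X Y} → inD X → inD Y → (r r′ : Hom Y X) (k : Hom X Y) →
                       r ∘ k ≡ id → r′ ∘ k ≡ id → r ≡ r′
  retractions-unique dX dY r r′ k r∘k r′∘k = G2-epic dX dY k dX r r′ (trans r∘k (sym r′∘k))

  section⇒inverse : ∀ {X Y} → inD X → inD Y → (r : Hom Y X) (k : Hom X Y) →
                    r ∘ k ≡ id → k ∘ r ≡ id
  section⇒inverse dX dY r k r∘k = G2-epic dX dY k dY (k ∘ r) id (begin
    (k ∘ r) ∘ k   ≡⟨ assoc k r k ⟩
    k ∘ (r ∘ k)   ≡⟨ cong (k ∘_) r∘k ⟩
    k ∘ id        ≡⟨ idʳ k ⟩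
    k             ≡⟨ sym (idˡ k) ⟩
    id ∘ k        ∎)

  sections-unique : ∀ {X Y} → inD X → inD Y → (r : Hom Y X) (k k′ : Hom X Y) →
                    r ∘ k ≡ id → r ∘ k′ ≡ id → k ≡ k′
  sections-unique dX dY r k k′ r∘k r∘k′ = begin
    k              ≡⟨ sym (idʳ k) ⟩
    k ∘ id         ≡⟨ cong (k ∘_) (sym r∘k′) ⟩
    k ∘ (r ∘ k′)   ≡⟨ sym (assoc k r k′) ⟩
    (k ∘ r) ∘ k′   ≡⟨ cong (_∘ k′) (section⇒inverse dX dY r k r∘k) ⟩
    id ∘ k′        ≡⟨ idˡ k′ ⟩
    k′             ∎

  sections-through-same-Sig : ∀ {U Y} → inD Y → (g : Hom U Y) (i : Sig U) (s s′ : Hom Y U) →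
                              g ∘ s ≡ id → g ∘ s′ ≡ id →
                              HomOver cat s (arr i) → HomOver cat s′ (arr i) → s ≡ s′
  sections-through-same-Sig dY g i s s′ g∘s g∘s′ (k , refl) (k′ , refl) =
    cong (arr i ∘_)
      (sections-unique dY (arrD i) (g ∘ arr i) k k′ (retraction g∘s) (retraction g∘s′))
    where
    retraction : ∀ {k} → g ∘ (arr i ∘ k) ≡ id → (g ∘ arr i) ∘ k ≡ id
    retraction {k} eq = trans (assoc g (arr i) k) eq

  g∘h≡g⇒deg[h]≡1 : ∀ {X Y} (dX : inD X) (dY : inD Y) (g : Hom X Y) (h : Hom X X) →
                   g ∘ h ≡ g → deg dX h ≡ 1
  g∘h≡g⇒deg[h]≡1 dX dY g h g∘h≡g =
    m*n≡m⇒n≡1 (deg dY g) (deg dX h) {{>-nonZero (deg-pos dY g)}}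
      (trans (sym (G4-mult dX dY g h)) (cong (deg dY) g∘h≡g))

  module SigCount {U Y} (dY : inD Y) (g : Hom U Y) {W : ℕ} (W≡deg : W ≡ deg dY g) =
    WeightedCount (proj₁ (proj₂ (G4-sum dY g))) (proj₁ (proj₂ (proj₂ (G4-sum dY g))))
                  (λ i → deg dY (g ∘ arr i)) (λ i → deg-pos dY (g ∘ arr i))
                  (trans W≡deg (proj₂ (proj₂ (proj₂ (G4-sum dY g)))))

  deg≡1⇒Sig-irrelevant : ∀ {U Y} (dY : inD Y) (g : Hom U Y) → deg dY g ≡ 1 → (i j : Sig U) → i ≡ j
  deg≡1⇒Sig-irrelevant dY g deg≡1 i j = index-injective (Fin1-irrelevant (index i) (index j))
    where open SigCount dY g (sym deg≡1)

  -- Σ(U) of the kernel pair U of g is a singleton, and the diagonal factors through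
  -- its element i; p ∘ i and q ∘ i are retractions of the same arrow, hence equal.
  deg≡1⇒iso : ∀ {X Y} (dX : inD X) (dY : inD Y) (g : Hom X Y) → deg dY g ≡ 1 → IsIso cat g
  deg≡1⇒iso {X} dX dY g deg≡1 with G1 dY dX dX g g
  ... | U , p , q , pb@(_ , universal) = G2-monic dX dY g monic
    where
    Sig-irrelevant : (i j : Sig U) → i ≡ j
    Sig-irrelevant =
      deg≡1⇒Sig-irrelevant dX p (trans (sym (proj₂ (G4-pb dY dX dX g g p q pb))) deg≡1)

    δ : Hom X U
    δ = proj₁ (universal id id refl)

    p∘δ : p ∘ δ ≡ id
    p∘δ = proj₁ (proj₁ (proj₂ (universal id id refl)))

    q∘δ : q ∘ δ ≡ id
    q∘δ = proj₂ (proj₁ (proj₂ (universal id id refl)))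

    i₀ : Sig U
    i₀ = proj₁ (G3-ex dX δ)

    k₀ : Hom X (SigElem.sdom (elem i₀))
    k₀ = proj₁ (proj₂ (G3-ex dX δ))

    δ≡i₀∘k₀ : δ ≡ arr i₀ ∘ k₀
    δ≡i₀∘k₀ = proj₂ (proj₂ (G3-ex dX δ))

    through-i₀ : ∀ (r : Hom U X) → r ∘ δ ≡ id → (r ∘ arr i₀) ∘ k₀ ≡ id
    through-i₀ r r∘δ = begin
      (r ∘ arr i₀) ∘ k₀   ≡⟨ assoc r (arr i₀) k₀ ⟩
      r ∘ (arr i₀ ∘ k₀)   ≡⟨ cong (r ∘_) (sym δ≡i₀∘k₀) ⟩
      r ∘ δ               ≡⟨ r∘δ ⟩
      id                  ∎

    p∘i≡q∘i : ∀ i → p ∘ arr i ≡ q ∘ arr i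
    p∘i≡q∘i i rewrite Sig-irrelevant i i₀ =
      retractions-unique dX (arrD i₀) (p ∘ arr i₀) (q ∘ arr i₀) k₀
        (through-i₀ p p∘δ) (through-i₀ q q∘δ)

    monic : IsMonicD cat inD g
    monic dW a b g∘a≡g∘b with universal a b g∘a≡g∘b
    ... | m , (p∘m , q∘m) , _ with G3-ex dW m
    ... | i , k , m≡i∘k = begin
      a                 ≡⟨ sym p∘m ⟩
      p ∘ m             ≡⟨ cong (p ∘_) m≡i∘k ⟩
      p ∘ (arr i ∘ k)   ≡⟨ sym (assoc p (arr i) k) ⟩
      (p ∘ arr i) ∘ k   ≡⟨ cong (_∘ k) (p∘i≡q∘i i) ⟩
      (q ∘ arr i) ∘ k   ≡⟨ assoc q (arr i) k ⟩
      q ∘ (arr i ∘ k)   ≡⟨ cong (q ∘_) (sym m≡i∘k) ⟩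
      q ∘ m             ≡⟨ q∘m ⟩
      b                 ∎

  module AutOfCover {A B} (dA : inD A) (dB : inD B) (f : Hom B A) where

    Aut-≡ : ∀ {x y : Aut f} → proj₁ x ≡ proj₁ y → x ≡ y
    Aut-≡ {h , iso , f≡f∘h} {.h , iso′ , f≡f∘h′} refl =
      cong₂ (λ a b → h , a , b) (IsIso-irrelevant {C = cat} iso iso′) (uip f≡f∘h f≡f∘h′)

    module KernelPair {U} (p q : Hom U B) (pb : IsPullback cat f f p q) where

      private
        commutes : f ∘ p ≡ f ∘ q
        commutes = proj₁ pb

        graph : (x : Aut f) → Σ (Hom B U) λ m → (p ∘ m ≡ id × q ∘ m ≡ proj₁ x) ×
                  (∀ m′ → p ∘ m′ ≡ id → q ∘ m′ ≡ proj₁ x → m′ ≡ m)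
        graph x = proj₂ pb id (proj₁ x) (trans (idʳ f) (proj₂ (proj₂ x)))

      section : Aut f → Hom B U
      section x = proj₁ (graph x)

      p∘section : ∀ x → p ∘ section x ≡ id
      p∘section x = proj₁ (proj₁ (proj₂ (graph x)))

      q∘section : ∀ x → q ∘ section x ≡ proj₁ x
      q∘section x = proj₂ (proj₁ (proj₂ (graph x)))

      section-unique : ∀ x (m : Hom B U) → p ∘ m ≡ id → q ∘ m ≡ proj₁ x → m ≡ section x
      section-unique x = proj₂ (proj₂ (graph x))

      φ : Aut f → Sig U
      φ x = proj₁ (G3-ex dB (section x))

      section-through-φ : ∀ x → HomOver cat (section x) (arr (φ x))
      section-through-φ x = proj₂ (G3-ex dB (section x))

      φ-injective : ∀ x y → φ x ≡ φ y → proj₁ x ≡ proj₁ y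
      φ-injective x y φx≡φy = begin
        proj₁ x         ≡⟨ sym (q∘section x) ⟩
        q ∘ section x   ≡⟨ cong (q ∘_) sections≡ ⟩
        q ∘ section y   ≡⟨ q∘section y ⟩
        proj₁ y         ∎
        where
        sections≡ : section x ≡ section y
        sections≡ = sections-through-same-Sig dB p (φ y) (section x) (section y)
          (p∘section x) (p∘section y)
          (subst (λ i → HomOver cat (section x) (arr i)) φx≡φy (section-through-φ x))
          (section-through-φ y)

      -- an inverse s of p ∘ i yields the automorphism h = q ∘ i ∘ s, whose section is i ∘ s
      φ-hits-deg≡1 : (i : Sig U) → deg dB (p ∘ arr i) ≡ 1 → Σ (Aut f) λ x → φ x ≡ i
      φ-hits-deg≡1 i deg≡1 with deg≡1⇒iso (arrD i) dB (p ∘ arr i) deg≡1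
      ... | s , _ , p∘i∘s≡id =
        x , G3-un dB (section x) (φ x) i (section-through-φ x) (s , sym i∘s≡section)
        where
        p∘[i∘s]≡id : p ∘ (arr i ∘ s) ≡ id
        p∘[i∘s]≡id = trans (sym (assoc p (arr i) s)) p∘i∘s≡id

        h : Hom B B
        h = q ∘ (arr i ∘ s)

        f∘h≡f : f ∘ h ≡ f
        f∘h≡f = begin
          f ∘ (q ∘ (arr i ∘ s))   ≡⟨ sym (assoc f q (arr i ∘ s)) ⟩
          (f ∘ q) ∘ (arr i ∘ s)   ≡⟨ cong (_∘ (arr i ∘ s)) (sym commutes) ⟩
          (f ∘ p) ∘ (arr i ∘ s)   ≡⟨ assoc f p (arr i ∘ s) ⟩
          f ∘ (p ∘ (arr i ∘ s))   ≡⟨ cong (f ∘_) p∘[i∘s]≡id ⟩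
          f ∘ id                  ≡⟨ idʳ f ⟩
          f                       ∎

        x : Aut f
        x = h , deg≡1⇒iso dB dB h (g∘h≡g⇒deg[h]≡1 dB dA f h f∘h≡f) , sym f∘h≡f

        i∘s≡section : arr i ∘ s ≡ section x
        i∘s≡section = section-unique x (arr i ∘ s) p∘[i∘s]≡id refl

      open SigCount dB p (proj₂ (G4-pb dA dB dB f f p q pb))

      Aut-index : Aut f → Fin (deg dA f)
      Aut-index x = index (φ x)

      Aut-index-injective : ∀ x y → Aut-index x ≡ Aut-index y → proj₁ x ≡ proj₁ y
      Aut-index-injective x y eq = φ-injective x y (index-injective eq)

      Galois⇒deg≡1 : IsGalois dA dB f → ∀ i → deg dB (p ∘ arr i) ≡ 1
      Galois⇒deg≡1 (ι , ι-injective , ι-surjective) = injection⇒weights≡1 χ χ-injective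
        where
        ι⁻¹ : Fin (deg dA f) → Aut f
        ι⁻¹ k = proj₁ (ι-surjective k)

        χ : Fin (deg dA f) → Sig U
        χ k = φ (ι⁻¹ k)

        χ-injective : Injective _≡_ _≡_ χ
        χ-injective {k} {l} χk≡χl = begin
          k            ≡⟨ sym (proj₂ (ι-surjective k)) ⟩
          ι (ι⁻¹ k)    ≡⟨ cong ι (Aut-≡ (φ-injective (ι⁻¹ k) (ι⁻¹ l) χk≡χl)) ⟩
          ι (ι⁻¹ l)    ≡⟨ proj₂ (ι-surjective l) ⟩
          l            ∎

      deg≡1⇒Galois : (∀ i → deg dB (p ∘ arr i) ≡ 1) → IsGalois dA dB f
      deg≡1⇒Galois ones = Aut-index , Aut-index-injective , surjective
        where
        surjective : ∀ k → Σ (Aut f) λ x → Aut-index x ≡ k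
        surjective k = via-φ (weights≡1⇒index-surjective ones k)
          where
          via-φ : Σ (Sig U) (λ i → index i ≡ k) → Σ (Aut f) λ x → Aut-index x ≡ k
          via-φ (i , index-i≡k) = hit (φ-hits-deg≡1 i (ones i))
            where
            hit : Σ (Aut f) (λ x → φ x ≡ i) → Σ (Aut f) λ x → Aut-index x ≡ k
            hit (x , φx≡i) = x , trans (cong index φx≡i) index-i≡k

      Galois⇔deg≡1 : IsGalois dA dB f ⇔ (∀ i → deg dB (p ∘ arr i) ≡ 1)
      Galois⇔deg≡1 = mk⇔ Galois⇒deg≡1 deg≡1⇒Galois

    Aut≤deg : AutCard≤ f (deg dA f)
    Aut≤deg with G1 dA dB dB f f
    ... | _ , p , q , pb = Aut-index , Aut-index-injective
      where open KernelPair p q pb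

corollary3p13 : ∀ {o ℓ : Level} (G : GaloisSetting o ℓ) →
    let open GaloisSetting G
        open Category cat
    in ∀ {A B} (dA : inD A) (dB : inD B) (f : Hom B A) →
       AutCard≤ f (deg dA f) ×
       (∀ {U} (p q : Hom U B) → IsPullback cat f f p q →
          (IsGalois dA dB f ⇔ (∀ (i : Sig U) → deg dB (p ∘ SigElem.sarr (elem i)) ≡ 1)) ×
          (IsGalois dA dB f ⇔ (∀ (i : Sig U) → deg dB (q ∘ SigElem.sarr (elem i)) ≡ 1)))
corollary3p13 G dA dB f =
  Aut≤deg , λ p q pb → Galois⇔deg≡1 p q pb , Galois⇔deg≡1 q p (IsPullback-swap {C = cat} pb)
  where
  open GaloisSetting G using (cat)
  open CoverTheory G
  open AutOfCover dA dB f
  open KernelPair using (Galois⇔deg≡1)
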